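{- There exists a standard Sudoku board that is fixed by no non-identity element of $G_9=H_9\times S_9$. Consequently the largest $G_9$-orbit on the set of Sudoku boards has size $|G_9|=1{,}218{,}998{,}108{,}160$, and $G_9$ is a minimal complete Sudoku symmetry group: no subgroup of $G_9$ of smaller order has the same orbits on the set of Sudoku boards as $G_9$.
   Context: A (standard) Sudoku board is a $9\times 9$ grid filled with the symbols $1,\dots,9$ so that each row, each column and each of the nine designated $3\times 3$ blocks contains each symbol exactly once. $H_9$ is the group of permutations of the $81$ cells generated by permutations of the bands (rows of blocks), permutations of the pillars (columns of blocks), permutations of rows within a band, permutations of columns within a pillar, and transpose; it has order $3{,}359{,}232$ and acts by moving entries. $S_9$ is the group of all $9!$ relabelings (permutations of the symbols applied to every entry). $G_9=H_9\times S_9$. -}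

module Defs where

open import Data.Nat using (ℕ; _<_)
open import Data.Fin using (Fin; combine; remQuot)
open import Data.Fin.Permutation using (Permutation′; _⟨$⟩ʳ_)
open import Data.Product using (Σ; ∃; _×_; _,_; proj₁; proj₂)
open import Data.Bool using (Bool)
open import Function using (id; _∘_)
open import Function.Definitions using (Bijective)
open import Function.Bundles using (_⇔_)
open import Relation.Binary.PropositionalEquality using (_≡_)
open import Relation.Nullary using (¬_)
open import Relation.Nullary.Decidable using (does)
open import Data.Fin using (_≟_)

-- A row (or column) index r : Fin 9 is identified with a pair
-- (band, row-in-band) : Fin 3 × Fin 3 via r = 3·band + row-in-band.
split : Fin 9 → Fin 3 × Fin 3
split = remQuot {3} 3

join : Fin 3 → Fin 3 → Fin 9
join = combine {3} {3}

-- A cell is (row , column).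
Cell : Set
Cell = Fin 9 × Fin 9

-- A board assigns a symbol 1..9 (encoded as Fin 9) to each cell.
Board : Set
Board = Cell → Fin 9

IsSudoku : Board → Set
IsSudoku B =
  (∀ r → Bijective _≡_ _≡_ (λ c → B (r , c))) ×
  (∀ c → Bijective _≡_ _≡_ (λ r → B (r , c))) ×
  (∀ b p → Bijective _≡_ _≡_ (λ (ij : Fin 3 × Fin 3) → B (join b (proj₁ ij) , join p (proj₂ ij))))

permBlock : Permutation′ 3 → Fin 9 → Fin 9
permBlock σ r = join (σ ⟨$⟩ʳ proj₁ (split r)) (proj₂ (split r))

permInside : Fin 3 → Permutation′ 3 → Fin 9 → Fin 9
permInside b σ r with does (proj₁ (split r) ≟ b)
... | Bool.true  = join (proj₁ (split r)) (σ ⟨$⟩ʳ proj₂ (split r))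
... | Bool.false = r

data Generator : Set where
  bands   : Permutation′ 3 → Generator
  pillars : Permutation′ 3 → Generator
  rowsIn  : Fin 3 → Permutation′ 3 → Generator
  colsIn  : Fin 3 → Permutation′ 3 → Generator
  transp  : Generator

gen : Generator → Cell → Cell
gen (bands σ)    (r , c) = (permBlock σ r , c)
gen (pillars σ)  (r , c) = (r , permBlock σ c)
gen (rowsIn b σ) (r , c) = (permInside b σ r , c)
gen (colsIn p σ) (r , c) = (r , permInside p σ c)
gen transp       (r , c) = (c , r)

-- H₉: the cell maps in the group generated by the generators.
-- (The generator set is closed under inverses and everything is finite,
-- so the generated monoid is the generated group.)
data InH9 : (Cell → Cell) → Set where
  h-id  : InH9 id
  h-gen : ∀ {h} (g : Generator) → InH9 h → InH9 (gen g ∘ h)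

record G9 : Set where
  constructor ⟪_,_,_⟫
  field
    cells   : Cell → Cell
    inH9    : InH9 cells
    relabel : Permutation′ 9
open G9 public

_≈G_ : G9 → G9 → Set
g ≈G g' = (∀ x → cells g x ≡ cells g' x) × (∀ i → relabel g ⟨$⟩ʳ i ≡ relabel g' ⟨$⟩ʳ i)

IsIdentity : G9 → Set
IsIdentity g = (∀ x → cells g x ≡ x) × (∀ i → relabel g ⟨$⟩ʳ i ≡ i)


_⟶[_]_ : Board → G9 → Board → Set
B ⟶[ g ] B' = ∀ x → B' (cells g x) ≡ relabel g ⟨$⟩ʳ B x

_≈B_ : Board → Board → Set
B ≈B B' = ∀ x → B x ≡ B' x

HasSize : {A : Set} → (A → A → Set) → (A → Set) → ℕ → Set
HasSize {A} _≈_ P n =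
  Σ (Fin n → A) λ f →
    (∀ i → P (f i)) ×
    (∀ i j → f i ≈ f j → i ≡ j) ×
    (∀ a → P a → ∃ λ i → f i ≈ a)

Orbit : Board → Board → Set
Orbit B B' = ∃ λ (g : G9) → B ⟶[ g ] B'

OrbitUnder : (G9 → Set) → Board → Board → Set
OrbitUnder K B B' = ∃ λ (g : G9) → K g × B ⟶[ g ] B'

IsSubgroup : (G9 → Set) → Set
IsSubgroup K =
  (∀ g g' → g ≈G g' → K g → K g') ×
  (∃ λ e → K e × IsIdentity e) ×
  (∀ g g' → K g → K g' → ∃ λ k → K k ×
      (∀ x → cells k x ≡ cells g (cells g' x)) ×
      (∀ i → relabel k ⟨$⟩ʳ i ≡ relabel g ⟨$⟩ʳ (relabel g' ⟨$⟩ʳ i))) ×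
  (∀ g → K g → ∃ λ k → K k ×
      (∀ x → cells k (cells g x) ≡ x) ×
      (∀ i → relabel k ⟨$⟩ʳ (relabel g ⟨$⟩ʳ i) ≡ i))

SameOrbits : (G9 → Set) → Set
SameOrbits K = ∀ B B' → IsSudoku B → IsSudoku B' → (Orbit B B' ⇔ OrbitUnder K B B')

-- |G₉| = 3359232 · 9!
orderG9 : ℕ
orderG9 = 1218998108160

module Submission where

-- H₉ is the group (S₃ ≀ S₃ × S₃ ≀ S₃) ⋊ C₂: every element is a "shape"
-- (optionally transpose, then move rows by a block permutation R and columns by a
-- block permutation C), and a block permutation is a permutation of the three
-- blocks together with a permutation of Fin 3 inside each block.  Hence H₉ is in
-- bijection with the 2·1296² = 3359232 shapes, and |G₉| = 3359232 · 9!.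
--
-- The explicit board B₀ is then rigid: if moving its entries by a shape c agrees
-- with a relabelling, c is the identity.  This is a finite search over shapes,
-- pruned block by block and decided by evaluation.  Rigidity makes g ↦ g · B₀
-- injective, so the orbit of B₀ has |G₉| elements; any orbit is the image of G₉,
-- hence no larger; and a subgroup with the same orbits as G₉ must reach all |G₉|
-- boards in the orbit of B₀, hence has at least |G₉| elements.

open import Defs
open import Data.Bool using (Bool; true; false; if_then_else_)
import Data.Bool.Properties as Bool
open import Data.Fin using (Fin; suc; punchIn; _≟_; combine; remQuot)
open import Data.Fin.Patterns
open import Data.Fin.Properties
  using (all?; any?; injective⇒≤; punchIn-injective; remQuot-combine; combine-remQuot; *↔×; 2↔Bool)
import Data.Fin.Permutation as Permutation
open import Data.Fin.Permutation using (Permutation′; _⟨$⟩ʳ_; _⟨$⟩ˡ_; inverseˡ; inverseʳ; permutation)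
  renaming (_≈_ to _≈ₚ_)
open import Data.Nat using (ℕ; zero; suc; _*_; _!; _≤_; _<_)
open import Data.Nat.Properties using (<⇒≱)
open import Data.Product using (Σ; ∃; _×_; _,_; proj₁; proj₂; uncurry; swap)
open import Data.Product.Function.NonDependent.Propositional using (_×-↔_)
open import Data.Product.Properties using () renaming (≡-dec to ×-≡-dec)
open import Data.Unit using (⊤; tt)
open import Data.Vec using (Vec; _∷_; []; lookup; tabulate)
open import Data.Vec.Properties using (lookup∘tabulate; tabulate-cong)
open import Function using (_∘_)
open import Function.Bundles using (_↔_; Inverse; mk↔ₛ′; Equivalence)
open import Function.Consequences.Propositional using (strictlySurjective⇒surjective)
import Function.Construct.Composition as Composition
open import Function.Definitions using (Bijective)
open import Function.Properties.Inverse using (↔-trans)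
open import Relation.Binary.Definitions using (DecidableEquality)
open import Relation.Binary.PropositionalEquality
open import Relation.Nullary using (Dec; ¬_)
open import Relation.Nullary.Decidable using (does; from-yes; map′; _×-dec_; _→-dec_; ¬?)

bijective : {A B : Set} (f : A → B) → (∀ x y → f x ≡ f y → x ≡ y) → (∀ y → ∃ λ x → f x ≡ y) →
  Bijective _≡_ _≡_ f
bijective f inj surj = (λ {x} {y} → inj x y) , strictlySurjective⇒surjective surj

bijective-inverse : {A B : Set} (f : A → B) (g : B → A) → (∀ x → g (f x) ≡ x) → (∀ y → f (g y) ≡ y) →
  Bijective _≡_ _≡_ f
bijective-inverse f g gf fg =
  bijective f (λ x y e → trans (sym (gf x)) (trans (cong g e) (gf y))) (λ y → g y , fg y)

bijective-∘ : {A B C : Set} {f : A → B} {g : B → C} →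
  Bijective _≡_ _≡_ f → Bijective _≡_ _≡_ g → Bijective _≡_ _≡_ (g ∘ f)
bijective-∘ = Composition.bijective _≡_ _≡_ _≡_

bijective-resp : {A B : Set} {f g : A → B} → (∀ x → f x ≡ g x) → Bijective _≡_ _≡_ f → Bijective _≡_ _≡_ g
bijective-resp {f = f} {g} f≗g (inj , surj) =
  bijective g (λ x y e → inj (trans (f≗g x) (trans e (sym (f≗g y)))))
              (λ y → proj₁ (surj y) , trans (sym (f≗g _)) (proj₂ (surj y) refl))

permutation-bijective : ∀ {n} (s : Permutation′ n) → Bijective _≡_ _≡_ (s ⟨$⟩ʳ_)
permutation-bijective s = bijective-inverse (s ⟨$⟩ʳ_) (s ⟨$⟩ˡ_) (λ _ → inverseˡ s) (λ _ → inverseʳ s)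

count-pairs : {A : Set} (_≈_ : A → A → Set) (P : A → Set) (n m : ℕ) (F : Fin n → Fin m → A) →
  (∀ a b → P (F a b)) → (∀ a b a′ b′ → F a b ≈ F a′ b′ → a ≡ a′ × b ≡ b′) →
  (∀ x → P x → ∃ λ a → ∃ λ b → F a b ≈ x) → HasSize _≈_ P (n * m)
count-pairs {A} _≈_ P n m F F∈P F-injective F-surjective = f , (λ _ → F∈P _ _) , injective , surjective
  where
  f : Fin (n * m) → A
  f = uncurry F ∘ remQuot {n} m
  injective : ∀ i j → f i ≈ f j → i ≡ j
  injective i j e with a≡a′ , b≡b′ ← F-injective _ _ _ _ e =
    trans (sym (combine-remQuot {n} m i)) (trans (cong₂ combine a≡a′ b≡b′) (combine-remQuot {n} m j))
  surjective : ∀ x → P x → ∃ λ i → f i ≈ x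
  surjective x x∈P with a , b , e ← F-surjective x x∈P =
    combine a b , subst (λ ab → uncurry F ab ≈ x) (sym (remQuot-combine a b)) e

insert-cong : ∀ {n} a {π ρ : Permutation′ n} → π ≈ₚ ρ →
  Permutation.insert 0F a π ≈ₚ Permutation.insert 0F a ρ
insert-cong a π≈ρ 0F = refl
insert-cong a {π} {ρ} π≈ρ (suc k) = trans (Permutation.insert-punchIn 0F a π k)
  (trans (cong (punchIn a) (π≈ρ k)) (sym (Permutation.insert-punchIn 0F a ρ k)))

-- There are n! permutations of Fin n: a permutation of Fin (suc n) is determined by
-- the image a of 0 together with the permutation of Fin n that remains (`insert 0F a`).
count-Permutation : ∀ n → HasSize (_≈ₚ_ {n}) (λ _ → ⊤) (n !)
count-Permutation zero = (λ _ → Permutation.id) , (λ _ → tt) , (λ { 0F 0F _ → refl }) , λ π _ → 0F , λ ()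
count-Permutation (suc n) with e , _ , e-injective , e-surjective ← count-Permutation n =
  count-pairs _≈ₚ_ (λ _ → ⊤) (suc n) (n !) F (λ _ _ → tt) F-injective F-surjective
  where
  F : Fin (suc n) → Fin (n !) → Permutation′ (suc n)
  F a k = Permutation.insert 0F a (e k)
  F-injective : ∀ a k a′ k′ → F a k ≈ₚ F a′ k′ → a ≡ a′ × k ≡ k′
  F-injective a k a′ k′ F≈ with refl ← F≈ 0F = refl , e-injective k k′ λ i → punchIn-injective a _ _
    (trans (sym (Permutation.insert-punchIn 0F a (e k) i))
           (trans (F≈ (suc i)) (Permutation.insert-punchIn 0F a (e k′) i)))
  F-surjective : ∀ π → ⊤ → ∃ λ a → ∃ λ k → F a k ≈ₚ π
  F-surjective π _ with k , ek≈ ← e-surjective (Permutation.remove 0F π) tt =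
    π ⟨$⟩ʳ 0F , k , λ i → trans (insert-cong (π ⟨$⟩ʳ 0F) ek≈ i) (Permutation.insert-remove 0F π i)

-- S₃ coded by Fin 6: a code p acts on Fin 3 by `act p`, listed by the images of 0, 1, 2.

S₃ : Set
S₃ = Fin 6

act : S₃ → Fin 3 → Fin 3
act p = lookup (lookup images p)
  where
  images : Vec (Vec (Fin 3) 3) 6
  images = (0F ∷ 1F ∷ 2F ∷ []) ∷ (0F ∷ 2F ∷ 1F ∷ []) ∷ (1F ∷ 0F ∷ 2F ∷ []) ∷
           (1F ∷ 2F ∷ 0F ∷ []) ∷ (2F ∷ 0F ∷ 1F ∷ []) ∷ (2F ∷ 1F ∷ 0F ∷ []) ∷ []

-- The code of the permutation sending 0 ↦ a and 1 ↦ b (for a ≢ b).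
codeOf : Fin 3 → Fin 3 → S₃
codeOf a b = lookup (lookup codes a) b
  where
  codes : Vec (Vec S₃ 3) 3
  codes = (0F ∷ 0F ∷ 1F ∷ []) ∷ (2F ∷ 0F ∷ 3F ∷ []) ∷ (4F ∷ 5F ∷ 0F ∷ []) ∷ []

infixr 7 _·_
_·_ : S₃ → S₃ → S₃
p · q = codeOf (act p (act q 0F)) (act p (act q 1F))

inv : S₃ → S₃
inv = lookup (0F ∷ 1F ∷ 2F ∷ 4F ∷ 3F ∷ 5F ∷ [])

act-· : ∀ p q i → act (p · q) i ≡ act p (act q i)
act-· = from-yes (all? λ p → all? λ q → all? λ i → act (p · q) i ≟ act p (act q i))

act-inv : ∀ p i → act (inv p) (act p i) ≡ i
act-inv = from-yes (all? λ p → all? λ i → act (inv p) (act p i) ≟ i)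

act-inv′ : ∀ p i → act p (act (inv p) i) ≡ i
act-inv′ = from-yes (all? λ p → all? λ i → act p (act (inv p) i) ≟ i)

act-id : ∀ i → act 0F i ≡ i
act-id = from-yes (all? λ i → act 0F i ≟ i)

codeOf-act : ∀ q → codeOf (act q 0F) (act q 1F) ≡ q
codeOf-act = from-yes (all? λ q → codeOf (act q 0F) (act q 1F) ≟ q)

codeOf-spec : ∀ a b c → a ≢ b → a ≢ c → b ≢ c → ∀ i → lookup (a ∷ b ∷ c ∷ []) i ≡ act (codeOf a b) i
codeOf-spec = from-yes (all? λ a → all? λ b → all? λ c → ¬? (a ≟ b) →-dec ¬? (a ≟ c) →-dec ¬? (b ≟ c) →-dec
  all? λ i → lookup (a ∷ b ∷ c ∷ []) i ≟ act (codeOf a b) i)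

codeOfPerm : Permutation′ 3 → S₃
codeOfPerm π = codeOf (π ⟨$⟩ʳ 0F) (π ⟨$⟩ʳ 1F)

codeOfPerm-spec : ∀ π i → π ⟨$⟩ʳ i ≡ act (codeOfPerm π) i
codeOfPerm-spec π i = trans (sym (lookup∘tabulate (π ⟨$⟩ʳ_) i))
  (codeOf-spec (π ⟨$⟩ʳ 0F) (π ⟨$⟩ʳ 1F) (π ⟨$⟩ʳ 2F) (distinct λ ()) (distinct λ ()) (distinct λ ()) i)
  where
  distinct : ∀ {x y} → x ≢ y → π ⟨$⟩ʳ x ≢ π ⟨$⟩ʳ y
  distinct x≢y e = x≢y (trans (sym (inverseˡ π)) (trans (cong (π ⟨$⟩ˡ_) e) (inverseˡ π)))

toPermutation : S₃ → Permutation′ 3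
toPermutation q = permutation (act q) (act (inv q)) (act-inv′ q) (act-inv q)

-- Block permutations: the wreath product S₃ ≀ S₃ acting on the nine rows (or columns).
-- The line join b i (line i of block b) goes to line (inner b) i of block (outer b).

record BlockPerm : Set where
  constructor blockPerm
  field
    outer inner₀ inner₁ inner₂ : S₃
open BlockPerm

inner : BlockPerm → Fin 3 → S₃
inner W 0F = inner₀ W
inner W 1F = inner₁ W
inner W 2F = inner₂ W

fromInner : S₃ → (Fin 3 → S₃) → BlockPerm
fromInner o τ = blockPerm o (τ 0F) (τ 1F) (τ 2F)

inner-fromInner : ∀ o τ b → inner (fromInner o τ) b ≡ τ b
inner-fromInner o τ 0F = refl
inner-fromInner o τ 1F = refl
inner-fromInner o τ 2F = refl

split-join : ∀ b i → split (join b i) ≡ (b , i)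
split-join = remQuot-combine

join-split : ∀ r → join (proj₁ (split r)) (proj₂ (split r)) ≡ r
join-split = combine-remQuot {3} 3

lineInduction : {P : Fin 9 → Set} → (∀ b i → P (join b i)) → ∀ r → P r
lineInduction {P} h r = subst P (join-split r) (h (proj₁ (split r)) (proj₂ (split r)))

lineMap : BlockPerm → Fin 9 → Fin 9
lineMap W r = uncurry (λ b i → join (act (outer W) b) (act (inner W b) i)) (split r)

lineMap-join : ∀ W b i → lineMap W (join b i) ≡ join (act (outer W) b) (act (inner W b) i)
lineMap-join W b i = cong (uncurry λ b i → join (act (outer W) b) (act (inner W b) i)) (split-join b i)

idᵇ : BlockPerm
idᵇ = blockPerm 0F 0F 0F 0F

lineMap-id : ∀ r → lineMap idᵇ r ≡ r
lineMap-id = from-yes (all? λ r → lineMap idᵇ r ≟ r)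

infixr 7 _∙ᵇ_
_∙ᵇ_ : BlockPerm → BlockPerm → BlockPerm
W ∙ᵇ V = fromInner (outer W · outer V) λ b → inner W (act (outer V) b) · inner V b

inner-∙ : ∀ W V b → inner (W ∙ᵇ V) b ≡ inner W (act (outer V) b) · inner V b
inner-∙ W V = inner-fromInner (outer W · outer V) λ b → inner W (act (outer V) b) · inner V b

lineMap-∙ : ∀ W V r → lineMap (W ∙ᵇ V) r ≡ lineMap W (lineMap V r)
lineMap-∙ W V = lineInduction λ b i → begin
  lineMap (W ∙ᵇ V) (join b i)
    ≡⟨ lineMap-join (W ∙ᵇ V) b i ⟩
  join (act (outer W · outer V) b) (act (inner (W ∙ᵇ V) b) i)
    ≡⟨ cong₂ join (act-· (outer W) (outer V) b)
                  (trans (cong (λ p → act p i) (inner-∙ W V b)) (act-· (inner W (act (outer V) b)) (inner V b) i)) ⟩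
  join (act (outer W) (act (outer V) b)) (act (inner W (act (outer V) b)) (act (inner V b) i))
    ≡⟨ lineMap-join W _ _ ⟨
  lineMap W (join (act (outer V) b) (act (inner V b) i))
    ≡⟨ cong (lineMap W) (lineMap-join V b i) ⟨
  lineMap W (lineMap V (join b i)) ∎
  where open ≡-Reasoning

infix 8 _⁻¹ᵇ
_⁻¹ᵇ : BlockPerm → BlockPerm
W ⁻¹ᵇ = fromInner (inv (outer W)) λ b → inv (inner W (act (inv (outer W)) b))

inner-⁻¹ : ∀ W b → inner (W ⁻¹ᵇ) b ≡ inv (inner W (act (inv (outer W)) b))
inner-⁻¹ W = inner-fromInner (inv (outer W)) λ b → inv (inner W (act (inv (outer W)) b))

lineMap-inverseˡ : ∀ W r → lineMap (W ⁻¹ᵇ) (lineMap W r) ≡ r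
lineMap-inverseˡ W = lineInduction λ b i → begin
  lineMap (W ⁻¹ᵇ) (lineMap W (join b i))
    ≡⟨ cong (lineMap (W ⁻¹ᵇ)) (lineMap-join W b i) ⟩
  lineMap (W ⁻¹ᵇ) (join (act o b) (act (inner W b) i))
    ≡⟨ lineMap-join (W ⁻¹ᵇ) _ _ ⟩
  join (act (inv o) (act o b)) (act (inner (W ⁻¹ᵇ) (act o b)) (act (inner W b) i))
    ≡⟨ cong₂ join (act-inv o b) (cong (λ p → act p (act (inner W b) i)) inner⁻¹) ⟩
  join b (act (inv (inner W b)) (act (inner W b) i))
    ≡⟨ cong (join b) (act-inv (inner W b) i) ⟩
  join b i ∎
  where
  open ≡-Reasoning
  o = outer W
  inner⁻¹ : ∀ {b} → inner (W ⁻¹ᵇ) (act o b) ≡ inv (inner W b)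
  inner⁻¹ {b} = trans (inner-⁻¹ W (act o b)) (cong (λ k → inv (inner W k)) (act-inv o b))

lineMap-inverseʳ : ∀ W r → lineMap W (lineMap (W ⁻¹ᵇ) r) ≡ r
lineMap-inverseʳ W = lineInduction onJoin
  where
  open ≡-Reasoning
  o = outer W
  onJoin : ∀ b i → lineMap W (lineMap (W ⁻¹ᵇ) (join b i)) ≡ join b i
  onJoin b i = begin
    lineMap W (lineMap (W ⁻¹ᵇ) (join b i))
      ≡⟨ cong (lineMap W) (lineMap-join (W ⁻¹ᵇ) b i) ⟩
    lineMap W (join b′ (act (inner (W ⁻¹ᵇ) b) i))
      ≡⟨ lineMap-join W _ _ ⟩
    join (act o b′) (act (inner W b′) (act (inner (W ⁻¹ᵇ) b) i))
      ≡⟨ cong₂ join (act-inv′ o b) (cong (λ p → act (inner W b′) (act p i)) (inner-⁻¹ W b)) ⟩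
    join b (act (inner W b′) (act (inv (inner W b′)) i))
      ≡⟨ cong (join b) (act-inv′ (inner W b′) i) ⟩
    join b i ∎
    where
    b′ = act (inv o) b

lineMap-injective : ∀ W {r s} → lineMap W r ≡ lineMap W s → r ≡ s
lineMap-injective W {r} {s} e =
  trans (sym (lineMap-inverseˡ W r)) (trans (cong (lineMap (W ⁻¹ᵇ)) e) (lineMap-inverseˡ W s))

lineMap-bijective : ∀ W → Bijective _≡_ _≡_ (lineMap W)
lineMap-bijective W = bijective-inverse (lineMap W) (lineMap (W ⁻¹ᵇ)) (lineMap-inverseˡ W) (lineMap-inverseʳ W)

blocksBy : S₃ → BlockPerm
blocksBy q = fromInner q λ _ → 0F

insideBy : Fin 3 → S₃ → BlockPerm
insideBy x q = fromInner 0F λ b → if does (b ≟ x) then q else 0F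

permBlock-lineMap : ∀ σ r → permBlock σ r ≡ lineMap (blocksBy (codeOfPerm σ)) r
permBlock-lineMap σ r = cong₂ join (codeOfPerm-spec σ b)
  (sym (trans (cong (λ p → act p i) (inner-fromInner (codeOfPerm σ) (λ _ → 0F) b)) (act-id i)))
  where
  b = proj₁ (split r)
  i = proj₂ (split r)

-- `permInside` is defined by a case split on the block of r; this exposes it as one formula.
permInside-split : ∀ x σ r → permInside x σ r ≡
  join (proj₁ (split r)) (if does (proj₁ (split r) ≟ x) then σ ⟨$⟩ʳ proj₂ (split r) else proj₂ (split r))
permInside-split x σ r with does (proj₁ (split r) ≟ x)
... | true  = refl
... | false = sym (join-split r)

permInside-lineMap : ∀ x σ r → permInside x σ r ≡ lineMap (insideBy x (codeOfPerm σ)) r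
permInside-lineMap x σ r = trans (permInside-split x σ r) (cong₂ join (sym (act-id b))
  (trans (inside (does (b ≟ x)))
         (cong (λ p → act p i) (sym (inner-fromInner 0F (λ k → if does (k ≟ x) then codeOfPerm σ else 0F) b)))))
  where
  b = proj₁ (split r)
  i = proj₂ (split r)
  inside : ∀ d → (if d then σ ⟨$⟩ʳ i else i) ≡ act (if d then codeOfPerm σ else 0F) i
  inside true  = codeOfPerm-spec σ i
  inside false = sym (act-id i)

-- Equality of block permutations is decidable, so identities among the 1296 of
-- them can be checked by evaluation.
infix 4 _≟ᵇ_
_≟ᵇ_ : DecidableEquality BlockPerm
blockPerm a b c d ≟ᵇ blockPerm a′ b′ c′ d′ =
  map′ (λ { (refl , refl , refl , refl) → refl }) (λ { refl → refl , refl , refl , refl })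
       (a ≟ a′ ×-dec b ≟ b′ ×-dec c ≟ c′ ×-dec d ≟ d′)

generated : ∀ o a b c → blockPerm o a b c ≡ blocksBy o ∙ᵇ (insideBy 2F c ∙ᵇ (insideBy 1F b ∙ᵇ insideBy 0F a))
generated = from-yes (all? λ o → all? λ a → all? λ b → all? λ c →
  blockPerm o a b c ≟ᵇ blocksBy o ∙ᵇ (insideBy 2F c ∙ᵇ (insideBy 1F b ∙ᵇ insideBy 0F a)))

-- A block permutation can be read off from the table of its action on lines,
-- so `lineMap` is faithful.
decodeᵇ : Vec (Fin 9) 9 → BlockPerm
decodeᵇ v = blockPerm (codeOf (band 0F 0F) (band 1F 0F)) (codeOf (pos 0F 0F) (pos 0F 1F))
                      (codeOf (pos 1F 0F) (pos 1F 1F)) (codeOf (pos 2F 0F) (pos 2F 1F))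
  where
  band pos : Fin 3 → Fin 3 → Fin 3
  band b i = proj₁ (split (lookup v (join b i)))
  pos b i = proj₂ (split (lookup v (join b i)))

decode-lineMap : ∀ o a b c → decodeᵇ (tabulate (lineMap (blockPerm o a b c))) ≡ blockPerm o a b c
decode-lineMap = from-yes (all? λ o → all? λ a → all? λ b → all? λ c →
  decodeᵇ (tabulate (lineMap (blockPerm o a b c))) ≟ᵇ blockPerm o a b c)

lineMap-faithful : ∀ W V → (∀ r → lineMap W r ≡ lineMap V r) → W ≡ V
lineMap-faithful W@(blockPerm _ _ _ _) V@(blockPerm _ _ _ _) h = begin
  W                              ≡⟨ decode-lineMap _ _ _ _ ⟨
  decodeᵇ (tabulate (lineMap W)) ≡⟨ cong decodeᵇ (tabulate-cong h) ⟩
  decodeᵇ (tabulate (lineMap V)) ≡⟨ decode-lineMap _ _ _ _ ⟩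
  V                              ∎
  where open ≡-Reasoning

record Shape : Set where
  constructor shape
  field
    transposed : Bool
    rowPerm colPerm : BlockPerm
open Shape

cellMap : Shape → Cell → Cell
cellMap (shape false R C) (r , c) = lineMap R r , lineMap C c
cellMap (shape true  R C) (r , c) = lineMap C c , lineMap R r

idˢ : Shape
idˢ = shape false idᵇ idᵇ

cellMap-id : ∀ x → cellMap idˢ x ≡ x
cellMap-id (r , c) = cong₂ _,_ (lineMap-id r) (lineMap-id c)

-- Composition: a transposition in the second factor swaps the roles of R and C in the first.
infixr 7 _⊙_
_⊙_ : Shape → Shape → Shape
shape false R C ⊙ shape false R′ C′ = shape false (R ∙ᵇ R′) (C ∙ᵇ C′)
shape true  R C ⊙ shape false R′ C′ = shape true  (R ∙ᵇ R′) (C ∙ᵇ C′)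
shape false R C ⊙ shape true  R′ C′ = shape true  (C ∙ᵇ R′) (R ∙ᵇ C′)
shape true  R C ⊙ shape true  R′ C′ = shape false (C ∙ᵇ R′) (R ∙ᵇ C′)

cellMap-⊙ : ∀ c d x → cellMap (c ⊙ d) x ≡ cellMap c (cellMap d x)
cellMap-⊙ (shape false R C) (shape false R′ C′) (r , s) = cong₂ _,_ (lineMap-∙ R R′ r) (lineMap-∙ C C′ s)
cellMap-⊙ (shape true  R C) (shape false R′ C′) (r , s) = cong₂ _,_ (lineMap-∙ C C′ s) (lineMap-∙ R R′ r)
cellMap-⊙ (shape false R C) (shape true  R′ C′) (r , s) = cong₂ _,_ (lineMap-∙ R C′ s) (lineMap-∙ C R′ r)
cellMap-⊙ (shape true  R C) (shape true  R′ C′) (r , s) = cong₂ _,_ (lineMap-∙ C R′ r) (lineMap-∙ R C′ s)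

infix 8 _⁻¹ˢ
_⁻¹ˢ : Shape → Shape
shape false R C ⁻¹ˢ = shape false (R ⁻¹ᵇ) (C ⁻¹ᵇ)
shape true  R C ⁻¹ˢ = shape true  (C ⁻¹ᵇ) (R ⁻¹ᵇ)

cellMap-inverseˡ : ∀ c x → cellMap (c ⁻¹ˢ) (cellMap c x) ≡ x
cellMap-inverseˡ (shape false R C) (r , s) = cong₂ _,_ (lineMap-inverseˡ R r) (lineMap-inverseˡ C s)
cellMap-inverseˡ (shape true  R C) (r , s) = cong₂ _,_ (lineMap-inverseˡ R r) (lineMap-inverseˡ C s)

cellMap-inverseʳ : ∀ c x → cellMap c (cellMap (c ⁻¹ˢ) x) ≡ x
cellMap-inverseʳ (shape false R C) (r , s) = cong₂ _,_ (lineMap-inverseʳ R r) (lineMap-inverseʳ C s)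
cellMap-inverseʳ (shape true  R C) (r , s) = cong₂ _,_ (lineMap-inverseʳ C r) (lineMap-inverseʳ R s)

-- Distinct shapes move cells differently.  A transposing and a non-transposing shape
-- differ because one keeps the row of (0,0) and (0,1) equal while the other does not.
cellMap-faithful : ∀ c d → (∀ x → cellMap c x ≡ cellMap d x) → c ≡ d
cellMap-faithful (shape false R C) (shape false R′ C′) h =
  cong₂ (shape false) (lineMap-faithful R R′ λ r → cong proj₁ (h (r , 0F)))
                      (lineMap-faithful C C′ λ s → cong proj₂ (h (0F , s)))
cellMap-faithful (shape true R C) (shape true R′ C′) h =
  cong₂ (shape true) (lineMap-faithful R R′ λ r → cong proj₂ (h (r , 0F)))
                     (lineMap-faithful C C′ λ s → cong proj₁ (h (0F , s)))
cellMap-faithful (shape false R C) (shape true R′ C′) h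
  with () ← lineMap-injective C′ {0F} {1F} (trans (sym (cong proj₁ (h (0F , 0F)))) (cong proj₁ (h (0F , 1F))))
cellMap-faithful (shape true R C) (shape false R′ C′) h
  with () ← lineMap-injective R′ {0F} {1F} (trans (sym (cong proj₁ (h (0F , 0F)))) (cong proj₁ (h (1F , 0F))))

infix 4 _≟ˢ_
_≟ˢ_ : DecidableEquality Shape
shape t R C ≟ˢ shape t′ R′ C′ =
  map′ (λ { (refl , refl , refl) → refl }) (λ { refl → refl , refl , refl })
       (t Bool.≟ t′ ×-dec R ≟ᵇ R′ ×-dec C ≟ᵇ C′)

HasShape : (Cell → Cell) → Shape → Set
HasShape h c = ∀ x → h x ≡ cellMap c x

generatorShape : Generator → Shape
generatorShape (bands σ)    = shape false (blocksBy (codeOfPerm σ)) idᵇ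
generatorShape (pillars σ)  = shape false idᵇ (blocksBy (codeOfPerm σ))
generatorShape (rowsIn x σ) = shape false (insideBy x (codeOfPerm σ)) idᵇ
generatorShape (colsIn x σ) = shape false idᵇ (insideBy x (codeOfPerm σ))
generatorShape transp       = shape true idᵇ idᵇ

gen-shape : ∀ g → HasShape (gen g) (generatorShape g)
gen-shape (bands σ)    (r , s) = cong₂ _,_ (permBlock-lineMap σ r) (sym (lineMap-id s))
gen-shape (pillars σ)  (r , s) = cong₂ _,_ (sym (lineMap-id r)) (permBlock-lineMap σ s)
gen-shape (rowsIn x σ) (r , s) = cong₂ _,_ (permInside-lineMap x σ r) (sym (lineMap-id s))
gen-shape (colsIn x σ) (r , s) = cong₂ _,_ (sym (lineMap-id r)) (permInside-lineMap x σ s)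
gen-shape transp       (r , s) = sym (cong₂ _,_ (lineMap-id s) (lineMap-id r))

classify : ∀ {h} → InH9 h → Σ Shape (HasShape h)
classify h-id = idˢ , λ x → sym (cellMap-id x)
classify (h-gen {h} g d) with c , h≗c ← classify d = generatorShape g ⊙ c , λ x → begin
  gen g (h x)                              ≡⟨ cong (gen g) (h≗c x) ⟩
  gen g (cellMap c x)                      ≡⟨ gen-shape g (cellMap c x) ⟩
  cellMap (generatorShape g) (cellMap c x) ≡⟨ cellMap-⊙ (generatorShape g) c x ⟨
  cellMap (generatorShape g ⊙ c) x         ∎
  where open ≡-Reasoning

shapeOf : G9 → Shape
shapeOf g = proj₁ (classify (inH9 g))

shapeOf-spec : ∀ g → HasShape (cells g) (shapeOf g)
shapeOf-spec g = proj₂ (classify (inH9 g))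

record Realizable (c : Shape) : Set where
  constructor realized
  field
    cellsOf : Cell → Cell
    cellsOf∈H₉ : InH9 cellsOf
    cellsOf-shape : HasShape cellsOf c
open Realizable

InH9-∘ : ∀ {h h′} → InH9 h → InH9 h′ → InH9 (h ∘ h′)
InH9-∘ h-id        d′ = d′
InH9-∘ (h-gen g d) d′ = h-gen g (InH9-∘ d d′)

realizable-⊙ : ∀ {c d} → Realizable c → Realizable d → Realizable (c ⊙ d)
realizable-⊙ {c} {d} (realized h h∈H h≗c) (realized h′ h′∈H h′≗d) =
  realized (h ∘ h′) (InH9-∘ h∈H h′∈H)
           λ x → trans (h≗c (h′ x)) (trans (cong (cellMap c) (h′≗d x)) (sym (cellMap-⊙ c d x)))

realizable-resp : ∀ {c d} → (∀ x → cellMap c x ≡ cellMap d x) → Realizable c → Realizable d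
realizable-resp c≗d (realized h h∈H h≗c) = realized h h∈H λ x → trans (h≗c x) (c≗d x)

realizable-gen : ∀ g → Realizable (generatorShape g)
realizable-gen g = realized (gen g) (h-gen g h-id) (gen-shape g)

-- Shapes acting on one axis only; note rowShape W ⊙ rowShape V reduces to rowShape (W ∙ᵇ V).
rowShape colShape : BlockPerm → Shape
rowShape W = shape false W idᵇ
colShape W = shape false idᵇ W

realizable-row : ∀ W → Realizable (rowShape W)
realizable-row (blockPerm o a b c) = subst (Realizable ∘ rowShape) (sym (generated o a b c))
  (realizable-⊙ (blocks o) (realizable-⊙ (inside 2F c) (realizable-⊙ (inside 1F b) (inside 0F a))))
  where
  blocks : ∀ q → Realizable (rowShape (blocksBy q))
  blocks q = subst (Realizable ∘ rowShape ∘ blocksBy) (codeOf-act q) (realizable-gen (bands (toPermutation q)))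
  inside : ∀ x q → Realizable (rowShape (insideBy x q))
  inside x q = subst (Realizable ∘ rowShape ∘ insideBy x) (codeOf-act q) (realizable-gen (rowsIn x (toPermutation q)))

realizable-col : ∀ W → Realizable (colShape W)
realizable-col (blockPerm o a b c) = subst (Realizable ∘ colShape) (sym (generated o a b c))
  (realizable-⊙ (blocks o) (realizable-⊙ (inside 2F c) (realizable-⊙ (inside 1F b) (inside 0F a))))
  where
  blocks : ∀ q → Realizable (colShape (blocksBy q))
  blocks q = subst (Realizable ∘ colShape ∘ blocksBy) (codeOf-act q) (realizable-gen (pillars (toPermutation q)))
  inside : ∀ x q → Realizable (colShape (insideBy x q))
  inside x q = subst (Realizable ∘ colShape ∘ insideBy x) (codeOf-act q) (realizable-gen (colsIn x (toPermutation q)))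

realize : ∀ c → Realizable c
realize (shape false R C) = realizable-resp rows-then-columns
  (realizable-⊙ (realizable-row R) (realizable-col C))
  where
  rows-then-columns : ∀ x → cellMap (rowShape R ⊙ colShape C) x ≡ cellMap (shape false R C) x
  rows-then-columns x@(r , s) = trans (cellMap-⊙ (rowShape R) (colShape C) x)
    (cong₂ _,_ (cong (lineMap R) (lineMap-id r)) (lineMap-id (lineMap C s)))
realize (shape true R C) = realizable-resp transpose-after
  (realizable-⊙ (realizable-gen transp) (realize (shape false R C)))
  where
  transpose-after : ∀ x → cellMap (generatorShape transp ⊙ shape false R C) x ≡ cellMap (shape true R C) x
  transpose-after x@(r , s) = trans (cellMap-⊙ (generatorShape transp) (shape false R C) x)
    (cong₂ _,_ (lineMap-id (lineMap C s)) (lineMap-id (lineMap R r)))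

element : Shape → Permutation′ 9 → G9
element c s = ⟪ cellsOf (realize c) , cellsOf∈H₉ (realize c) , s ⟫

element-shape : ∀ c s → HasShape (cells (element c s)) c
element-shape c s = cellsOf-shape (realize c)

element-injective : ∀ c s c′ s′ → element c s ≈G element c′ s′ → c ≡ c′ × s ≈ₚ s′
element-injective c s c′ s′ (same-cells , same-relabel) =
  cellMap-faithful c c′ (λ x → trans (sym (element-shape c s x)) (trans (same-cells x) (element-shape c′ s′ x))) ,
  same-relabel

element-≈ : ∀ c s g → HasShape (cells g) c → s ≈ₚ relabel g → element c s ≈G g
element-≈ c s g g≗c s≈ = (λ x → trans (element-shape c s x) (sym (g≗c x))) , s≈

BlockPerm↔ : Fin 1296 ↔ BlockPerm
BlockPerm↔ = ↔-trans (*↔× {36} {36}) (↔-trans (*↔× {6} {6} ×-↔ *↔× {6} {6})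
  (mk↔ₛ′ (λ ((o , a) , (b , c)) → blockPerm o a b c) (λ W → (outer W , inner₀ W) , (inner₁ W , inner₂ W))
         (λ _ → refl) (λ _ → refl)))

Shape↔ : Fin 3359232 ↔ Shape
Shape↔ = ↔-trans (*↔× {2} {1296 * 1296})
  (↔-trans (2↔Bool ×-↔ ↔-trans (*↔× {1296} {1296}) (BlockPerm↔ ×-↔ BlockPerm↔))
           (mk↔ₛ′ (λ (t , R , C) → shape t R C) (λ c → transposed c , rowPerm c , colPerm c)
                  (λ _ → refl) (λ _ → refl)))

shapeAt : Fin 3359232 → Shape
shapeAt = Inverse.to Shape↔

shapeAt-injective : ∀ {a a′} → shapeAt a ≡ shapeAt a′ → a ≡ a′
shapeAt-injective {a} {a′} e = trans (sym (Inverse.strictlyInverseʳ Shape↔ a))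
  (trans (cong (Inverse.from Shape↔) e) (Inverse.strictlyInverseʳ Shape↔ a′))

shapeAt-surjective : ∀ c → ∃ λ a → shapeAt a ≡ c
shapeAt-surjective c = Inverse.from Shape↔ c , Inverse.strictlyInverseˡ Shape↔ c

relabelAt : Fin 362880 → Permutation′ 9
relabelAt = proj₁ (count-Permutation 9)

relabelAt-injective : ∀ b b′ → relabelAt b ≈ₚ relabelAt b′ → b ≡ b′
relabelAt-injective = proj₁ (proj₂ (proj₂ (count-Permutation 9)))

relabelAt-surjective : ∀ s → ∃ λ b → relabelAt b ≈ₚ s
relabelAt-surjective s = proj₂ (proj₂ (proj₂ (count-Permutation 9))) s tt

-- |G₉| = |shapes| · 9!, because (c , s) ↦ element c s is a bijection onto G₉.
count-G9 : HasSize _≈G_ (λ _ → ⊤) orderG9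
count-G9 = count-pairs _≈G_ (λ _ → ⊤) 3359232 362880 (λ a b → element (shapeAt a) (relabelAt b)) (λ _ _ → tt)
  (λ a b a′ b′ same →
     let same-shape , same-relabel = element-injective (shapeAt a) (relabelAt b) (shapeAt a′) (relabelAt b′) same
     in shapeAt-injective same-shape , relabelAt-injective b b′ same-relabel)
  λ g _ → let a , a-shape = shapeAt-surjective (shapeOf g) ; b , b-relabel = relabelAt-surjective (relabel g) in
    a , b , element-≈ (shapeAt a) (relabelAt b) g (subst (HasShape (cells g)) (sym a-shape) (shapeOf-spec g)) b-relabel

-- The board B₀ (symbols 1..9 written as 0F..8F); its top-left block lists the
-- symbols in order, so each symbol v sits at the cell `cellOf₀ v` of that block.

grid : Vec (Vec (Fin 9) 9) 9
grid =
  (0F ∷ 1F ∷ 2F ∷ 3F ∷ 5F ∷ 7F ∷ 6F ∷ 8F ∷ 4F ∷ []) ∷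
  (3F ∷ 4F ∷ 5F ∷ 2F ∷ 6F ∷ 8F ∷ 7F ∷ 0F ∷ 1F ∷ []) ∷
  (6F ∷ 7F ∷ 8F ∷ 4F ∷ 1F ∷ 0F ∷ 5F ∷ 3F ∷ 2F ∷ []) ∷
  (4F ∷ 8F ∷ 0F ∷ 6F ∷ 7F ∷ 3F ∷ 1F ∷ 2F ∷ 5F ∷ []) ∷
  (7F ∷ 6F ∷ 1F ∷ 5F ∷ 0F ∷ 2F ∷ 8F ∷ 4F ∷ 3F ∷ []) ∷
  (5F ∷ 2F ∷ 3F ∷ 8F ∷ 4F ∷ 1F ∷ 0F ∷ 6F ∷ 7F ∷ []) ∷
  (2F ∷ 5F ∷ 6F ∷ 1F ∷ 8F ∷ 4F ∷ 3F ∷ 7F ∷ 0F ∷ []) ∷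
  (1F ∷ 0F ∷ 4F ∷ 7F ∷ 3F ∷ 6F ∷ 2F ∷ 5F ∷ 8F ∷ []) ∷
  (8F ∷ 3F ∷ 7F ∷ 0F ∷ 2F ∷ 5F ∷ 4F ∷ 1F ∷ 6F ∷ []) ∷ []

B₀ : Board
B₀ (r , c) = lookup (lookup grid r) c

B₀-rows : ∀ r → Bijective _≡_ _≡_ (λ c → B₀ (r , c))
B₀-rows r = bijective _ (injective r) (surjective r)
  where
  injective : ∀ r c c′ → B₀ (r , c) ≡ B₀ (r , c′) → c ≡ c′
  injective = from-yes (all? λ r → all? λ c → all? λ c′ → B₀ (r , c) ≟ B₀ (r , c′) →-dec c ≟ c′)
  surjective : ∀ r v → ∃ λ c → B₀ (r , c) ≡ v
  surjective = from-yes (all? λ r → all? λ v → any? λ c → B₀ (r , c) ≟ v)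

B₀-columns : ∀ c → Bijective _≡_ _≡_ (λ r → B₀ (r , c))
B₀-columns c = bijective _ (injective c) (surjective c)
  where
  injective : ∀ c r r′ → B₀ (r , c) ≡ B₀ (r′ , c) → r ≡ r′
  injective = from-yes (all? λ c → all? λ r → all? λ r′ → B₀ (r , c) ≟ B₀ (r′ , c) →-dec r ≟ r′)
  surjective : ∀ c v → ∃ λ r → B₀ (r , c) ≡ v
  surjective = from-yes (all? λ c → all? λ v → any? λ r → B₀ (r , c) ≟ v)

B₀-blocks : ∀ b p → Bijective _≡_ _≡_ (λ (ij : Fin 3 × Fin 3) → B₀ (join b (proj₁ ij) , join p (proj₂ ij)))
B₀-blocks b p = bijective _ (λ { (i , j) (i′ , j′) → injective b p i j i′ j′ })
                            (λ v → let i , j , e = surjective b p v in (i , j) , e)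
  where
  injective : ∀ b p i j i′ j′ →
    B₀ (join b i , join p j) ≡ B₀ (join b i′ , join p j′) → (i , j) ≡ (i′ , j′)
  injective = from-yes (all? λ b → all? λ p → all? λ i → all? λ j → all? λ i′ → all? λ j′ →
    B₀ (join b i , join p j) ≟ B₀ (join b i′ , join p j′) →-dec ×-≡-dec _≟_ _≟_ (i , j) (i′ , j′))
  surjective : ∀ b p v → ∃ λ i → ∃ λ j → B₀ (join b i , join p j) ≡ v
  surjective = from-yes (all? λ b → all? λ p → all? λ v → any? λ i → any? λ j → B₀ (join b i , join p j) ≟ v)

B₀-sudoku : IsSudoku B₀
B₀-sudoku = B₀-rows , B₀-columns , B₀-blocks

cellOf₀ : Fin 9 → Cell
cellOf₀ v = uncurry (λ i j → join 0F i , join 0F j) (split v)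

B₀-cellOf₀ : ∀ v → B₀ (cellOf₀ v) ≡ v
B₀-cellOf₀ = from-yes (all? λ v → B₀ (cellOf₀ v) ≟ v)

-- If moving the entries of B₀ by c agrees with a relabelling s,
-- then s is forced to be `induced c` (read off on the top-left block), and c is
-- "compatible" with B₀ on every cell.

induced : Shape → Fin 9 → Fin 9
induced c v = B₀ (cellMap c (cellOf₀ v))

Compatible : Shape → Cell → Set
Compatible c x = B₀ (cellMap c x) ≡ induced c (B₀ x)

compatible? : ∀ c x → Dec (Compatible c x)
compatible? c x = B₀ (cellMap c x) ≟ induced c (B₀ x)

FullyCompatible : Shape → Set
FullyCompatible c = ∀ r s → Compatible c (r , s)

-- Compatibility on one block, written as an explicit nine-fold conjunction so
-- that it computes on the concrete cells of the block.
Triple : (Fin 3 → Set) → Set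
Triple P = P 0F × P 1F × P 2F

triple : {P : Fin 3 → Set} → (∀ i → P i) → Triple P
triple f = f 0F , f 1F , f 2F

triple? : {P : Fin 3 → Set} → (∀ i → Dec (P i)) → Dec (Triple P)
triple? P? = P? 0F ×-dec P? 1F ×-dec P? 2F

BlockCompatible : Shape → Fin 3 → Fin 3 → Set
BlockCompatible c b p = Triple λ i → Triple λ j → Compatible c (join b i , join p j)

blockCompatible? : ∀ c b p → Dec (BlockCompatible c b p)
blockCompatible? c b p = triple? λ i → triple? λ j → compatible? c (join b i , join p j)

blockCompatible : ∀ c → FullyCompatible c → ∀ b p → BlockCompatible c b p
blockCompatible c ok b p = triple λ i → triple λ j → ok (join b i) (join p j)

shape⁸ : Bool → S₃ → S₃ → S₃ → S₃ → S₃ → S₃ → S₃ → S₃ → Shape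
shape⁸ t oR r₀ r₁ r₂ oC c₀ c₁ c₂ = shape t (blockPerm oR r₀ r₁ r₂) (blockPerm oC c₀ c₁ c₂)

-- The pruned search.  `induced c` only depends on oR, r₀, oC, c₀; compatibility on
-- block (1,0) then only involves r₁, on block (2,0) only r₂, and on block (0,1) only
-- c₁.  So the shape components not yet chosen can be set to 0F while testing these
-- blocks, which cuts the 2·6⁸ shapes down to a search that evaluation handles.
RigiditySearch : Bool → Set
RigiditySearch t =
  ∀ oR r₀ oC c₀ r₁ → BlockCompatible (shape⁸ t oR r₀ r₁ 0F oC c₀ 0F 0F) 1F 0F →
  ∀ r₂ → BlockCompatible (shape⁸ t oR r₀ r₁ r₂ oC c₀ 0F 0F) 2F 0F →
  ∀ c₁ → BlockCompatible (shape⁸ t oR r₀ r₁ r₂ oC c₀ c₁ 0F) 0F 1F →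
  ∀ c₂ → FullyCompatible (shape⁸ t oR r₀ r₁ r₂ oC c₀ c₁ c₂) →
  shape⁸ t oR r₀ r₁ r₂ oC c₀ c₁ c₂ ≡ idˢ

rigiditySearch? : ∀ t → Dec (RigiditySearch t)
rigiditySearch? t =
  all? λ oR → all? λ r₀ → all? λ oC → all? λ c₀ → all? λ r₁ →
  blockCompatible? (shape⁸ t oR r₀ r₁ 0F oC c₀ 0F 0F) 1F 0F →-dec all? λ r₂ →
  blockCompatible? (shape⁸ t oR r₀ r₁ r₂ oC c₀ 0F 0F) 2F 0F →-dec all? λ c₁ →
  blockCompatible? (shape⁸ t oR r₀ r₁ r₂ oC c₀ c₁ 0F) 0F 1F →-dec all? λ c₂ →
  (all? λ r → all? λ s → compatible? (shape⁸ t oR r₀ r₁ r₂ oC c₀ c₁ c₂) (r , s)) →-dec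
  (shape⁸ t oR r₀ r₁ r₂ oC c₀ c₁ c₂ ≟ˢ idˢ)

rigiditySearch : ∀ t → RigiditySearch t
rigiditySearch false = from-yes (rigiditySearch? false)
rigiditySearch true  = from-yes (rigiditySearch? true)

-- The block tests of the search coincide definitionally with those of the full shape
-- (the zeroed components are never inspected), so the search applies.
fullyCompatible⇒id : ∀ c → FullyCompatible c → c ≡ idˢ
fullyCompatible⇒id c@(shape false (blockPerm oR r₀ r₁ r₂) (blockPerm oC c₀ c₁ c₂)) ok =
  rigiditySearch false oR r₀ oC c₀ r₁ (blockCompatible c ok 1F 0F) r₂ (blockCompatible c ok 2F 0F)
                       c₁ (blockCompatible c ok 0F 1F) c₂ ok
fullyCompatible⇒id c@(shape true (blockPerm oR r₀ r₁ r₂) (blockPerm oC c₀ c₁ c₂)) ok =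
  rigiditySearch true oR r₀ oC c₀ r₁ (blockCompatible c ok 1F 0F) r₂ (blockCompatible c ok 2F 0F)
                      c₁ (blockCompatible c ok 0F 1F) c₂ ok

B₀-rigid : ∀ c (s : Fin 9 → Fin 9) → (∀ x → B₀ (cellMap c x) ≡ s (B₀ x)) → c ≡ idˢ × (∀ v → s v ≡ v)
B₀-rigid c s moves = c≡id , s≡id
  where
  s≗induced : ∀ v → s v ≡ induced c v
  s≗induced v = trans (cong s (sym (B₀-cellOf₀ v))) (sym (moves (cellOf₀ v)))
  c≡id : c ≡ idˢ
  c≡id = fullyCompatible⇒id c λ r t → trans (moves (r , t)) (s≗induced (B₀ (r , t)))
  s≡id : ∀ v → s v ≡ v
  s≡id v = begin
    s v                          ≡⟨ s≗induced v ⟩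
    B₀ (cellMap c (cellOf₀ v))   ≡⟨ cong (λ d → B₀ (cellMap d (cellOf₀ v))) c≡id ⟩
    B₀ (cellMap idˢ (cellOf₀ v)) ≡⟨ cong B₀ (cellMap-id (cellOf₀ v)) ⟩
    B₀ (cellOf₀ v)               ≡⟨ B₀-cellOf₀ v ⟩
    v                            ∎
    where open ≡-Reasoning

B₀-stabiliser : ∀ g → B₀ ⟶[ g ] B₀ → IsIdentity g
B₀-stabiliser g fixes = cells-id , proj₂ rigid
  where
  rigid : shapeOf g ≡ idˢ × (∀ v → relabel g ⟨$⟩ʳ v ≡ v)
  rigid = B₀-rigid (shapeOf g) (relabel g ⟨$⟩ʳ_) λ x → trans (cong B₀ (sym (shapeOf-spec g x))) (fixes x)
  cells-id : ∀ x → cells g x ≡ x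
  cells-id x = trans (shapeOf-spec g x) (trans (cong (λ d → cellMap d x) (proj₁ rigid)) (cellMap-id x))

moved : Shape → Permutation′ 9 → Board → Board
moved c s B y = s ⟨$⟩ʳ B (cellMap (c ⁻¹ˢ) y)

moved-reached : ∀ B g c → HasShape (cells g) c → B ⟶[ g ] moved c (relabel g) B
moved-reached B g c g≗c x =
  trans (cong (moved c (relabel g) B) (g≗c x)) (cong (λ y → relabel g ⟨$⟩ʳ B y) (cellMap-inverseˡ c x))

reached-moved : ∀ {B B′} g c → HasShape (cells g) c → B ⟶[ g ] B′ → B′ ≈B moved c (relabel g) B
reached-moved {B} {B′} g c g≗c reaches y = begin
  B′ y                               ≡⟨ cong B′ (cellMap-inverseʳ c y) ⟨
  B′ (cellMap c (cellMap (c ⁻¹ˢ) y)) ≡⟨ cong B′ (g≗c _) ⟨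
  B′ (cells g (cellMap (c ⁻¹ˢ) y))   ≡⟨ reaches _ ⟩
  moved c (relabel g) B y            ∎
  where open ≡-Reasoning

reached-unique : ∀ {B B₁ B₂ g g′} → g ≈G g′ → B ⟶[ g ] B₁ → B ⟶[ g′ ] B₂ → B₁ ≈B B₂
reached-unique {g = g} {g′} (same-cells , same-relabel) reaches₁ reaches₂ y =
  trans (reached-moved g (shapeOf g) (shapeOf-spec g) reaches₁ y)
        (trans (same-relabel _) (sym (reached-moved g′ (shapeOf g) g′-shape reaches₂ y)))
  where
  g′-shape : HasShape (cells g′) (shapeOf g)
  g′-shape x = trans (sym (same-cells x)) (shapeOf-spec g x)

act²-bijective : ∀ p q → Bijective _≡_ _≡_ (λ (ij : Fin 3 × Fin 3) → act p (proj₁ ij) , act q (proj₂ ij))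
act²-bijective p q = bijective-inverse _ (λ ij → act (inv p) (proj₁ ij) , act (inv q) (proj₂ ij))
  (λ ij → cong₂ _,_ (act-inv p _) (act-inv q _)) (λ ij → cong₂ _,_ (act-inv′ p _) (act-inv′ q _))

-- Moving rows and columns by block permutations and relabelling preserves Sudoku:
-- rows go to rows, and block (b , p) is block (outer R b , outer C p) reindexed.
sudoku-lines : ∀ {B} → IsSudoku B → ∀ R C (s : Permutation′ 9) →
  IsSudoku (λ x → s ⟨$⟩ʳ B (lineMap R (proj₁ x) , lineMap C (proj₂ x)))
sudoku-lines {B} (rows , columns , blocks) R C s =
  (λ r → bijective-∘ (lineMap-bijective C) (bijective-∘ (rows (lineMap R r)) (permutation-bijective s))) ,
  (λ c → bijective-∘ (lineMap-bijective R) (bijective-∘ (columns (lineMap C c)) (permutation-bijective s))) ,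
  λ b p → bijective-resp
    (λ ij → cong (λ x → s ⟨$⟩ʳ B x) (sym (cong₂ _,_ (lineMap-join R b _) (lineMap-join C p _))))
    (bijective-∘ (act²-bijective (inner R b) (inner C p))
                 (bijective-∘ (blocks (act (outer R) b) (act (outer C) p)) (permutation-bijective s)))

sudoku-transpose : ∀ {B} → IsSudoku B → IsSudoku (λ x → B (proj₂ x , proj₁ x))
sudoku-transpose (rows , columns , blocks) =
  columns , rows , λ b p → bijective-∘ (bijective-inverse swap swap (λ _ → refl) (λ _ → refl)) (blocks p b)

sudoku-moved : ∀ {B} → IsSudoku B → ∀ c s → IsSudoku (moved c s B)
sudoku-moved B-sudoku (shape false R C) s = sudoku-lines B-sudoku (R ⁻¹ᵇ) (C ⁻¹ᵇ) s
sudoku-moved B-sudoku (shape true  R C) s = sudoku-transpose (sudoku-lines B-sudoku (R ⁻¹ᵇ) (C ⁻¹ᵇ) s)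

sudoku-resp : ∀ {B B′} → B ≈B B′ → IsSudoku B → IsSudoku B′
sudoku-resp B≈B′ (rows , columns , blocks) =
  (λ r → bijective-resp (λ c → B≈B′ _) (rows r)) ,
  (λ c → bijective-resp (λ r → B≈B′ _) (columns c)) ,
  λ b p → bijective-resp (λ ij → B≈B′ _) (blocks b p)

orbit-sudoku : ∀ {B B′} → IsSudoku B → Orbit B B′ → IsSudoku B′
orbit-sudoku B-sudoku (g , reaches) =
  sudoku-resp (λ y → sym (reached-moved g (shapeOf g) (shapeOf-spec g) reaches y))
              (sudoku-moved B-sudoku (shapeOf g) (relabel g))

-- By rigidity, distinct group elements move B₀ to distinct boards.
moved-B₀-injective : ∀ c s c′ s′ → moved c s B₀ ≈B moved c′ s′ B₀ → c ≡ c′ × s ≈ₚ s′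
moved-B₀-injective c s c′ s′ same = c≡c′ , s≈s′
  where
  open ≡-Reasoning
  d = c′ ⁻¹ˢ ⊙ c
  t : Fin 9 → Fin 9
  t v = s′ ⟨$⟩ˡ (s ⟨$⟩ʳ v)
  d-moves : ∀ x → B₀ (cellMap d x) ≡ t (B₀ x)
  d-moves x = begin
    B₀ (cellMap d x)                     ≡⟨ cong B₀ (cellMap-⊙ (c′ ⁻¹ˢ) c x) ⟩
    B₀ (cellMap (c′ ⁻¹ˢ) (cellMap c x))  ≡⟨ inverseˡ s′ ⟨
    s′ ⟨$⟩ˡ moved c′ s′ B₀ (cellMap c x) ≡⟨ cong (s′ ⟨$⟩ˡ_) (same (cellMap c x)) ⟨
    s′ ⟨$⟩ˡ moved c s B₀ (cellMap c x)   ≡⟨ cong (λ y → t (B₀ y)) (cellMap-inverseˡ c x) ⟩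
    t (B₀ x)                             ∎
  rigid : d ≡ idˢ × (∀ v → t v ≡ v)
  rigid = B₀-rigid d t d-moves
  c≡c′ : c ≡ c′
  c≡c′ = cellMap-faithful c c′ λ x → begin
    cellMap c x                                 ≡⟨ cellMap-inverseʳ c′ (cellMap c x) ⟨
    cellMap c′ (cellMap (c′ ⁻¹ˢ) (cellMap c x)) ≡⟨ cong (cellMap c′) (cellMap-⊙ (c′ ⁻¹ˢ) c x) ⟨
    cellMap c′ (cellMap d x)                    ≡⟨ cong (λ e → cellMap c′ (cellMap e x)) (proj₁ rigid) ⟩
    cellMap c′ (cellMap idˢ x)                  ≡⟨ cong (cellMap c′) (cellMap-id x) ⟩
    cellMap c′ x                                ∎
  s≈s′ : s ≈ₚ s′
  s≈s′ v = trans (sym (inverseʳ s′)) (cong (s′ ⟨$⟩ʳ_) (proj₂ rigid v))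

orbit-B₀ : HasSize _≈B_ (Orbit B₀) orderG9
orbit-B₀ = count-pairs _≈B_ (Orbit B₀) 3359232 362880 (λ a b → moved (shapeAt a) (relabelAt b) B₀)
  (λ a b → element (shapeAt a) (relabelAt b) ,
           moved-reached B₀ (element (shapeAt a) (relabelAt b)) (shapeAt a) (element-shape (shapeAt a) (relabelAt b)))
  (λ a b a′ b′ same →
     let same-shape , same-relabel = moved-B₀-injective (shapeAt a) (relabelAt b) (shapeAt a′) (relabelAt b′) same
     in shapeAt-injective same-shape , relabelAt-injective b b′ same-relabel)
  λ B′ (g , reaches) → let a , a-shape = shapeAt-surjective (shapeOf g) ; b , b-relabel = relabelAt-surjective (relabel g) in
    a , b , λ y → trans (cong (λ c → moved c (relabelAt b) B₀ y) a-shape)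
                        (trans (b-relabel _) (sym (reached-moved g (shapeOf g) (shapeOf-spec g) reaches y)))

-- N distinct boards, each reached from B by an element of a set Q of size M, force N ≤ M:
-- sending each board to (the index of) an element reaching it is injective.
reach-bound : ∀ B {N M} (Q : G9 → Set) (f : Fin N → Board) → (∀ i j → f i ≈B f j → i ≡ j) →
  (∀ i → ∃ λ g → Q g × B ⟶[ g ] f i) → HasSize _≈G_ Q M → N ≤ M
reach-bound B Q f f-injective reached (e , _ , _ , e-surjective) = injective⇒≤ index-injective
  where
  witness : ∀ i → G9
  witness i = proj₁ (reached i)
  reaches : ∀ i → B ⟶[ witness i ] f i
  reaches i = proj₂ (proj₂ (reached i))
  index : Fin _ → Fin _
  index i = proj₁ (e-surjective (witness i) (proj₁ (proj₂ (reached i))))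
  index-spec : ∀ i → e (index i) ≈G witness i
  index-spec i = proj₂ (e-surjective (witness i) (proj₁ (proj₂ (reached i))))
  same-witness : ∀ i j → index i ≡ index j → witness i ≈G witness j
  same-witness i j same =
    (λ x → trans (sym (proj₁ (index-spec i) x))
                 (trans (cong (λ k → cells (e k) x) same) (proj₁ (index-spec j) x))) ,
    (λ v → trans (sym (proj₂ (index-spec i) v))
                 (trans (cong (λ k → relabel (e k) ⟨$⟩ʳ v) same) (proj₂ (index-spec j) v)))
  index-injective : ∀ {i j} → index i ≡ index j → i ≡ j
  index-injective {i} {j} same = f-injective i j
    (reached-unique {B} {f i} {f j} {witness i} {witness j} (same-witness i j same) (reaches i) (reaches j))

-- Every orbit is the image of G₉, so no orbit is larger than |G₉|.
orbit-bound : ∀ B n → HasSize _≈B_ (Orbit B) n → n ≤ orderG9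
orbit-bound B n (f , f∈orbit , f-injective , _) =
  reach-bound B (λ _ → ⊤) f f-injective (λ i → proj₁ (f∈orbit i) , tt , proj₂ (f∈orbit i)) count-G9

-- A subset K with the same orbits on Sudoku boards reaches all |G₉| boards of the
-- orbit of B₀ (all of which are Sudoku boards), so K has at least |G₉| elements.
minimality : ∀ K n → SameOrbits K → HasSize _≈G_ K n → ¬ (n < orderG9)
minimality K n same size n<|G₉| = <⇒≱ n<|G₉| (reach-bound B₀ K f f-injective reachedInK size)
  where
  f : Fin orderG9 → Board
  f = proj₁ orbit-B₀
  f∈orbit : ∀ i → Orbit B₀ (f i)
  f∈orbit = proj₁ (proj₂ orbit-B₀)
  f-injective : ∀ i j → f i ≈B f j → i ≡ j
  f-injective = proj₁ (proj₂ (proj₂ orbit-B₀))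
  reachedInK : ∀ i → ∃ λ g → K g × B₀ ⟶[ g ] f i
  reachedInK i = Equivalence.to (same B₀ (f i) B₀-sudoku (orbit-sudoku {B₀} {f i} B₀-sudoku (f∈orbit i))) (f∈orbit i)

mainTheorem10 : (∃ λ (B : Board) → IsSudoku B × (∀ (g : G9) → B ⟶[ g ] B → IsIdentity g)) ×
    HasSize _≈G_ (λ _ → ⊤) orderG9 ×
    (∃ λ (B : Board) → IsSudoku B × HasSize _≈B_ (Orbit B) orderG9) ×
    (∀ (B : Board) (n : ℕ) → IsSudoku B → HasSize _≈B_ (Orbit B) n → n ≤ orderG9) ×
    (∀ (K : G9 → Set) (n : ℕ) → IsSubgroup K → SameOrbits K → HasSize _≈G_ K n → ¬ (n < orderG9))
mainTheorem10 =
  (B₀ , B₀-sudoku , B₀-stabiliser) ,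
  count-G9 ,
  (B₀ , B₀-sudoku , orbit-B₀) ,
  (λ B n _ → orbit-bound B n) ,
  (λ K n _ → minimality K n)
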